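{- Let $r\geq 2$ and let $(P,\mathcal{L})$ be an $r$-uniform linear system with $\Delta(P,\mathcal{L})\geq \nu_2(P,\mathcal{L})-1$. Then $$\nu_2(P,\mathcal{L})-1\leq \frac{|P|+|\mathcal{L}|}{r+1}.$$
   Context: A linear system is a pair $(P,\mathcal{L})$ where $P$ is a finite set (points) and $\mathcal{L}$ is a family of subsets of $P$ (lines) such that $|l\cap l'|\leq 1$ for all distinct $l,l'\in\mathcal{L}$; it is $r$-uniform if every line has exactly $r$ points. The degree of a point is the number of lines containing it, and $\Delta(P,\mathcal{L})$ is the maximum degree. A 2-packing is a set $R\subseteq\mathcal{L}$ such that no three lines of $R$ have a common point; $\nu_2(P,\mathcal{L})$ is the maximum size of a 2-packing. -}

module Defs where

open import Data.Nat using (ℕ; _≤_; _⊔_)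
open import Data.Fin using (Fin)
open import Data.Fin.Subset using (Subset; ∣_∣; _∩_)
open import Data.Vec using (tabulate; lookup)
open import Data.List using (foldr; map; allFin)
open import Data.Product using (Σ; _×_)
open import Relation.Binary.PropositionalEquality using (_≡_; _≢_)

System : ℕ → ℕ → Set
System n m = Fin m → Subset n

-- the lines form a *set* of subsets: distinct indices give distinct lines
DistinctLines : ∀ {n m} → System n m → Set
DistinctLines {m = m} L = (i j : Fin m) → L i ≡ L j → i ≡ j

Linear : ∀ {n m} → System n m → Set
Linear {m = m} L = (i j : Fin m) → i ≢ j → ∣ L i ∩ L j ∣ ≤ 1

Uniform : ∀ {n m} → ℕ → System n m → Set
Uniform {m = m} r L = (i : Fin m) → ∣ L i ∣ ≡ r

linesThrough : ∀ {n m} → System n m → Fin n → Subset m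
linesThrough L p = tabulate (λ i → lookup (L i) p)

degree : ∀ {n m} → System n m → Fin n → ℕ
degree L p = ∣ linesThrough L p ∣

-- maximum degree (0 if there are no points)
maxDegree : ∀ {n m} → System n m → ℕ
maxDegree {n} L = foldr _⊔_ 0 (map (degree L) (allFin n))

Is2Packing : ∀ {n m} → System n m → Subset m → Set
Is2Packing {n} L R = (p : Fin n) → ∣ R ∩ linesThrough L p ∣ ≤ 2

IsNu2 : ∀ {n m} → System n m → ℕ → Set
IsNu2 {m = m} L ν =
  Σ (Subset m) (λ R → Is2Packing L R × ∣ R ∣ ≡ ν)
  × ((R : Subset m) → Is2Packing L R → ∣ R ∣ ≤ ν)

-- Let p be a point of maximum degree d, so ν - 1 ≤ d. Two lines through p meet
-- only in p, so they cover d (r - 1) + 1 points; counting the pairs (q, line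
-- through p and q) gives d r < d + |P|. A 2-packing R contains at most two of
-- the lines through p, so d + ν ≤ |L| + 2. Hence
--   (ν - 1)(r + 1) ≤ d r + (ν - 1) < |P| + d + ν - 1 ≤ |P| + |L| + 1.
module Submission where

open import Defs
open import Data.Bool using (Bool; true; false; _∧_)
open import Data.Fin using (Fin; zero; suc; _≟_; punchIn)
open import Data.Fin.Properties as Fin using (punchInᵢ≢i)
open import Data.Fin.Subset
  using (Subset; ∣_∣; _∩_; _∪_; inside; outside; _∈_; ⁅_⁆; ⊥; Empty)
open import Data.Fin.Subset.Properties
  using (∣p∣≤n; ∩-comm; ∩-idem; ∣⊥∣≡0; Empty-unique; p⊆q⇒∣p∣≤∣q∣; ∣⁅x⁆∣≡1;
         x∈⁅y⁆⇒x≡y; x∈p∩q⁺; x∈p∩q⁻)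
open import Data.List.Membership.Propositional.Properties
  using (foldr-selective; ∈-map⁻)
open import Data.List using (map; allFin)
open import Data.Nat using (ℕ; _≤_; _<_; _+_; _*_; _∸_; suc; zero; z≤n; s≤s)
open import Data.Nat.Properties hiding (_≟_)
open import Data.Product using (∃; _×_; _,_)
open import Data.Sum using (_⊎_; inj₁; inj₂)
open import Data.Vec using ([]; _∷_; lookup; here; there)
open import Data.Vec.Functional using (Vector; removeAt)
open import Data.Vec.Properties using (lookup-zipWith; lookup∘tabulate; []=⇒lookup; lookup⇒[]=)
open import Function using (_∘_)
open import Relation.Binary.PropositionalEquality
open import Relation.Nullary using (yes; no; contradiction)

open import Algebra.Properties.Semiring.Sum +-*-semiring
  using (sum; sum-syntax; sum-remove; ∑-comm; *-distribˡ-sum; *-distribʳ-sum; sum-cong-≗)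

sum≤n*c : ∀ {n c} (t : Vector ℕ n) → (∀ i → t i ≤ c) → sum t ≤ n * c
sum≤n*c {zero}  t t≤c = z≤n
sum≤n*c {suc n} t t≤c = +-mono-≤ (t≤c zero) (sum≤n*c (t ∘ suc) (t≤c ∘ suc))

sum≤t[i]+n : ∀ {n} (t : Vector ℕ (suc n)) i → (∀ j → j ≢ i → t j ≤ 1) → sum t ≤ t i + n
sum≤t[i]+n {n} t i t≤1 = begin
  sum t                    ≡⟨ sum-remove {i = i} t ⟩
  t i + sum (removeAt t i) ≤⟨ +-monoʳ-≤ (t i) (sum≤n*c (removeAt t i) (λ j → t≤1 (punchIn i j) (punchInᵢ≢i i j))) ⟩
  t i + n * 1              ≡⟨ cong (t i +_) (*-identityʳ n) ⟩
  t i + n                  ∎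
  where open ≤-Reasoning

toℕ : Bool → ℕ
toℕ true  = 1
toℕ false = 0

toℕ-∧ : ∀ x y → toℕ (x ∧ y) ≡ toℕ x * toℕ y
toℕ-∧ true  y = sym (*-identityˡ (toℕ y))
toℕ-∧ false y = refl

∣p∣≡∑ : ∀ {n} (p : Subset n) → ∣ p ∣ ≡ ∑[ i < n ] toℕ (lookup p i)
∣p∣≡∑ []            = refl
∣p∣≡∑ (inside ∷ p)  = cong suc (∣p∣≡∑ p)
∣p∣≡∑ (outside ∷ p) = ∣p∣≡∑ p

∣p∪q∣+∣p∩q∣≡∣p∣+∣q∣ : ∀ {n} (p q : Subset n) → ∣ p ∪ q ∣ + ∣ p ∩ q ∣ ≡ ∣ p ∣ + ∣ q ∣
∣p∪q∣+∣p∩q∣≡∣p∣+∣q∣ []            []            = refl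
∣p∪q∣+∣p∩q∣≡∣p∣+∣q∣ (inside ∷ p)  (inside ∷ q)  =
  cong suc (trans (+-suc _ _) (trans (cong suc (∣p∪q∣+∣p∩q∣≡∣p∣+∣q∣ p q)) (sym (+-suc _ _))))
∣p∪q∣+∣p∩q∣≡∣p∣+∣q∣ (inside ∷ p)  (outside ∷ q) = cong suc (∣p∪q∣+∣p∩q∣≡∣p∣+∣q∣ p q)
∣p∪q∣+∣p∩q∣≡∣p∣+∣q∣ (outside ∷ p) (inside ∷ q)  = trans (cong suc (∣p∪q∣+∣p∩q∣≡∣p∣+∣q∣ p q)) (sym (+-suc _ _))
∣p∪q∣+∣p∩q∣≡∣p∣+∣q∣ (outside ∷ p) (outside ∷ q) = ∣p∪q∣+∣p∩q∣≡∣p∣+∣q∣ p q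

x∈p⇒1≤∣p∣ : ∀ {n} {p : Subset n} {x} → x ∈ p → 1 ≤ ∣ p ∣
x∈p⇒1≤∣p∣ {p = p} {x} x∈p = begin
  1         ≡⟨ ∣⁅x⁆∣≡1 x ⟨
  ∣ ⁅ x ⁆ ∣ ≤⟨ p⊆q⇒∣p∣≤∣q∣ (λ y∈⁅x⁆ → subst (_∈ p) (sym (x∈⁅y⁆⇒x≡y x y∈⁅x⁆)) x∈p) ⟩
  ∣ p ∣     ∎
  where open ≤-Reasoning

∣p∣≤1⇒∈-unique : ∀ {n} {p : Subset n} {x y} → ∣ p ∣ ≤ 1 → x ∈ p → y ∈ p → x ≡ y
∣p∣≤1⇒∈-unique {p = inside ∷ p} _ here here = refl
∣p∣≤1⇒∈-unique {p = inside ∷ p} (s≤s ∣p∣≤0) here (there y∈p) = contradiction (≤-trans (x∈p⇒1≤∣p∣ y∈p) ∣p∣≤0) λ ()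
∣p∣≤1⇒∈-unique {p = inside ∷ p} (s≤s ∣p∣≤0) (there x∈p) _ = contradiction (≤-trans (x∈p⇒1≤∣p∣ x∈p) ∣p∣≤0) λ ()
∣p∣≤1⇒∈-unique {p = outside ∷ p} ∣p∣≤1 (there x∈p) (there y∈p) = cong suc (∣p∣≤1⇒∈-unique ∣p∣≤1 x∈p y∈p)

∈-unique⇒∣p∣≤1 : ∀ {n} {p : Subset n} → (∀ {x y} → x ∈ p → y ∈ p → x ≡ y) → ∣ p ∣ ≤ 1
∈-unique⇒∣p∣≤1 {p = []} _ = z≤n
∈-unique⇒∣p∣≤1 {p = outside ∷ p} unique = ∈-unique⇒∣p∣≤1 (λ x∈p y∈p → Fin.suc-injective (unique (there x∈p) (there y∈p)))
∈-unique⇒∣p∣≤1 {suc n} {inside ∷ p} unique =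
  s≤s (≤-reflexive (trans (cong ∣_∣ (Empty-unique p-empty)) (∣⊥∣≡0 n)))
  where
  p-empty : Empty p
  p-empty (_ , x∈p) = contradiction (unique here (there x∈p)) λ ()

module _ {n m : ℕ} (L : System n m) where

  lookup-linesThrough : ∀ p i → lookup (linesThrough L p) i ≡ lookup (L i) p
  lookup-linesThrough p = lookup∘tabulate (λ i → lookup (L i) p)

  ∈-linesThrough⁻ : ∀ {p i} → i ∈ linesThrough L p → p ∈ L i
  ∈-linesThrough⁻ {p} {i} i∈ = lookup⇒[]= p (L i) (trans (sym (lookup-linesThrough p i)) ([]=⇒lookup i∈))

  degree≡∑ : ∀ p → degree L p ≡ ∑[ i < m ] toℕ (lookup (L i) p)
  degree≡∑ p = trans (∣p∣≡∑ (linesThrough L p)) (sum-cong-≗ (cong toℕ ∘ lookup-linesThrough p))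

  ∣linesThrough∩linesThrough∣≡∑ : ∀ p q →
    ∣ linesThrough L p ∩ linesThrough L q ∣ ≡ ∑[ i < m ] (toℕ (lookup (L i) p) * toℕ (lookup (L i) q))
  ∣linesThrough∩linesThrough∣≡∑ p q = trans (∣p∣≡∑ (linesThrough L p ∩ linesThrough L q)) (sum-cong-≗ λ i → begin
    toℕ (lookup (linesThrough L p ∩ linesThrough L q) i)
      ≡⟨ cong toℕ (lookup-zipWith _∧_ i (linesThrough L p) (linesThrough L q)) ⟩
    toℕ (lookup (linesThrough L p) i ∧ lookup (linesThrough L q) i)
      ≡⟨ cong₂ (λ x y → toℕ (x ∧ y)) (lookup-linesThrough p i) (lookup-linesThrough q i) ⟩
    toℕ (lookup (L i) p ∧ lookup (L i) q)
      ≡⟨ toℕ-∧ (lookup (L i) p) (lookup (L i) q) ⟩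
    toℕ (lookup (L i) p) * toℕ (lookup (L i) q)
      ∎)
    where open ≡-Reasoning

  ∑-∣linesThrough∩linesThrough∣ : ∀ p →
    ∑[ q < n ] ∣ linesThrough L p ∩ linesThrough L q ∣ ≡ ∑[ i < m ] (toℕ (lookup (L i) p) * ∣ L i ∣)
  ∑-∣linesThrough∩linesThrough∣ p = begin
    ∑[ q < n ] ∣ linesThrough L p ∩ linesThrough L q ∣     ≡⟨ sum-cong-≗ (∣linesThrough∩linesThrough∣≡∑ p) ⟩
    ∑[ q < n ] ∑[ i < m ] (incidence p i * incidence q i)  ≡⟨ ∑-comm (λ q i → incidence p i * incidence q i) ⟩
    ∑[ i < m ] ∑[ q < n ] (incidence p i * incidence q i)  ≡⟨ sum-cong-≗ (λ i → *-distribˡ-sum (incidence p i) (λ q → incidence q i)) ⟨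
    ∑[ i < m ] (incidence p i * ∑[ q < n ] incidence q i)  ≡⟨ sum-cong-≗ (λ i → cong (incidence p i *_) (∣p∣≡∑ (L i))) ⟨
    ∑[ i < m ] (incidence p i * ∣ L i ∣)                   ∎
    where
    open ≡-Reasoning
    incidence : Fin n → Fin m → ℕ
    incidence q i = toℕ (lookup (L i) q)

  ∑-∣linesThrough∩linesThrough∣-uniform : ∀ {r} → Uniform r L → ∀ p →
    ∑[ q < n ] ∣ linesThrough L p ∩ linesThrough L q ∣ ≡ degree L p * r
  ∑-∣linesThrough∩linesThrough∣-uniform {r} uniform p = begin
    ∑[ q < n ] ∣ linesThrough L p ∩ linesThrough L q ∣  ≡⟨ ∑-∣linesThrough∩linesThrough∣ p ⟩
    ∑[ i < m ] (toℕ (lookup (L i) p) * ∣ L i ∣)          ≡⟨ sum-cong-≗ (λ i → cong (toℕ (lookup (L i) p) *_) (uniform i)) ⟩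
    ∑[ i < m ] (toℕ (lookup (L i) p) * r)               ≡⟨ *-distribʳ-sum r (λ i → toℕ (lookup (L i) p)) ⟨
    (∑[ i < m ] toℕ (lookup (L i) p)) * r               ≡⟨ cong (_* r) (degree≡∑ p) ⟨
    degree L p * r                                      ∎
    where open ≡-Reasoning

  ∣linesThrough∩linesThrough∣≤1 : Linear L → ∀ {p q} → q ≢ p → ∣ linesThrough L p ∩ linesThrough L q ∣ ≤ 1
  ∣linesThrough∩linesThrough∣≤1 linear {p} {q} q≢p = ∈-unique⇒∣p∣≤1 unique
    where
    through-p-and-q : ∀ {i} → i ∈ linesThrough L p ∩ linesThrough L q → p ∈ L i × q ∈ L i
    through-p-and-q i∈ with x∈p∩q⁻ _ _ i∈
    ... | i∈Tp , i∈Tq = ∈-linesThrough⁻ i∈Tp , ∈-linesThrough⁻ i∈Tq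
    unique : ∀ {i j} → i ∈ linesThrough L p ∩ linesThrough L q → j ∈ linesThrough L p ∩ linesThrough L q → i ≡ j
    unique {i} {j} i∈ j∈ with i ≟ j | through-p-and-q i∈ | through-p-and-q j∈
    ... | yes i≡j | _ | _ = i≡j
    ... | no i≢j | p∈Li , q∈Li | p∈Lj , q∈Lj =
      contradiction (∣p∣≤1⇒∈-unique (linear i j i≢j) (x∈p∩q⁺ (q∈Li , q∈Lj)) (x∈p∩q⁺ (p∈Li , p∈Lj))) q≢p

  degree+∣R∣≤m+2 : ∀ {R} → Is2Packing L R → ∀ p → degree L p + ∣ R ∣ ≤ m + 2
  degree+∣R∣≤m+2 {R} packing p = begin
    ∣ linesThrough L p ∣ + ∣ R ∣                         ≡⟨ ∣p∪q∣+∣p∩q∣≡∣p∣+∣q∣ (linesThrough L p) R ⟨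
    ∣ linesThrough L p ∪ R ∣ + ∣ linesThrough L p ∩ R ∣  ≤⟨ +-mono-≤ (∣p∣≤n (linesThrough L p ∪ R)) ∣linesThrough∩R∣≤2 ⟩
    m + 2                                               ∎
    where
    open ≤-Reasoning
    ∣linesThrough∩R∣≤2 : ∣ linesThrough L p ∩ R ∣ ≤ 2
    ∣linesThrough∩R∣≤2 = subst (_≤ 2) (cong ∣_∣ (∩-comm R (linesThrough L p))) (packing p)

  maxDegree≡0⊎degree : maxDegree L ≡ 0 ⊎ ∃ λ p → maxDegree L ≡ degree L p
  maxDegree≡0⊎degree with foldr-selective ⊔-sel 0 (map (degree L) (allFin n))
  ... | inj₁ ≡0 = inj₁ ≡0
  ... | inj₂ ∈degrees with ∈-map⁻ (degree L) ∈degrees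
  ...   | p , _ , ≡degree = inj₂ (p , ≡degree)

degree*r<degree+n : ∀ {n m r} (L : System n m) → Linear L → Uniform r L → ∀ p → degree L p * r < degree L p + n
degree*r<degree+n {suc n} {r = r} L linear uniform p = begin-strict
  degree L p * r                                         ≡⟨ ∑-∣linesThrough∩linesThrough∣-uniform L uniform p ⟨
  ∑[ q < suc n ] ∣ linesThrough L p ∩ linesThrough L q ∣  ≤⟨ sum≤t[i]+n _ p (λ q → ∣linesThrough∩linesThrough∣≤1 L linear) ⟩
  ∣ linesThrough L p ∩ linesThrough L p ∣ + n             ≡⟨ cong (λ s → ∣ s ∣ + n) (∩-idem (linesThrough L p)) ⟩
  degree L p + n                                         <⟨ +-monoʳ-< (degree L p) (n<1+n n) ⟩
  degree L p + suc n                                     ∎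
  where open ≤-Reasoning

k*[1+r]≤n+m : ∀ {k d r n m} → k ≤ d → d * r < d + n → d + suc k ≤ m + 2 → k * suc r ≤ n + m
k*[1+r]≤n+m {k} {d} {r} {n} {m} k≤d dr<d+n d+1+k≤m+2 = +-cancelˡ-≤ 2 (k * suc r) (n + m) (begin
  2 + k * suc r          ≡⟨ cong (2 +_) (*-suc k r) ⟩
  2 + (k + k * r)        ≡⟨ cong suc (+-suc k (k * r)) ⟨
  suc k + suc (k * r)    ≤⟨ +-monoʳ-≤ (suc k) (s≤s (*-monoˡ-≤ r k≤d)) ⟩
  suc k + suc (d * r)    ≤⟨ +-monoʳ-≤ (suc k) dr<d+n ⟩
  suc k + (d + n)        ≡⟨ +-assoc (suc k) d n ⟨
  (suc k + d) + n        ≡⟨ cong (_+ n) (+-comm (suc k) d) ⟩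
  (d + suc k) + n        ≤⟨ +-monoˡ-≤ n d+1+k≤m+2 ⟩
  (m + 2) + n            ≡⟨ +-assoc m 2 n ⟩
  m + (2 + n)            ≡⟨ +-comm m (2 + n) ⟩
  2 + (n + m)            ∎)
  where open ≤-Reasoning

theorem2p12 : (n m r : ℕ) (L : System n m) → 2 ≤ r → DistinctLines L → Linear L → Uniform r L
    → (ν : ℕ) → IsNu2 L ν → ν ∸ 1 ≤ maxDegree L
    → (ν ∸ 1) * suc r ≤ n + m
theorem2p12 n m r L _ _ linear uniform zero _ _ = z≤n
theorem2p12 n m r L _ _ linear uniform (suc k) ((R , packing , ∣R∣≡ν) , _) k≤Δ with maxDegree≡0⊎degree L
... | inj₁ Δ≡0 rewrite n≤0⇒n≡0 (subst (k ≤_) Δ≡0 k≤Δ) = z≤n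
... | inj₂ (p , Δ≡d) = k*[1+r]≤n+m
  (subst (k ≤_) Δ≡d k≤Δ)
  (degree*r<degree+n L linear uniform p)
  (subst (λ s → degree L p + s ≤ m + 2) ∣R∣≡ν (degree+∣R∣≤m+2 L {R} packing p))
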